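{- Let $p$ be a prime, $d\geq 2$ with $d\mid p-1$, $A,C\in\mathbb{F}_p$ with $A\neq 0$, $f(X)=AX^d+C$, $\gamma\in\mathbb{F}_p$ a fixed primitive $d$-th root of unity, and $k\geq 1$, $r\geq -1$. If $G_1$ and $G_2$ are complete proper $(r,k,d)$-graphs with $G_1\neq G_2$, then $\mathcal{C}_{G_1}\neq\mathcal{C}_{G_2}$.
   Context: Iterates: $f^{\circ 0}(X)=X$, $f^{\circ(j+1)}=f\circ f^{\circ j}$. An $(r,k,d)$-graph is a graph $G$ with vertex set $\{1,\dots,k\}$ together with, for each edge $\overline{ab}$, values $\xi_G(a,b),\xi_G(b,a)\in\{ -1,\dots,r\}$ and $\eta_G(a,b),\eta_G(b,a)\in\{0,\dots,d-1\}$ such that $\xi_G(a,b)=\xi_G(b,a)$, $\eta_G(a,b)+\eta_G(b,a)\equiv 0\pmod d$, $\eta=0$ when $\xi=-1$, and $\eta\in\{1,\dots,d-1\}$ when $\xi\geq 0$. Two such graphs are equal if they have the same edges and the same values of $\xi,\eta$. Complete: every pair of distinct vertices is joined. Proper: for all distinct vertices $a,b,c$ with $\overline{ab},\overline{ac},\overline{bc}$ edges: (1) if $\xi_G(a,b)=\xi_G(b,c)=-1$ then $\xi_G(a,c)=-1$; (2) if $\xi_G(a,b)<\xi_G(b,c)$ then $\xi_G(a,c)=\xi_G(b,c)$ and $\eta_G(a,c)=\eta_G(b,c)$; (3) if $0\leq\xi_G(a,b)=\xi_G(b,c)$ and $\eta_G(a,b)+\eta_G(b,c)\neq d$ then $\xi_G(a,c)=\xi_G(a,b)$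 and $\eta_G(a,c)\equiv\eta_G(a,b)+\eta_G(b,c)\pmod d$; (4) if $0\leq\xi_G(a,b)=\xi_G(b,c)$ and $\eta_G(a,b)+\eta_G(b,c)=d$ then $\xi_G(a,c)<\xi_G(a,b)$. $\Phi(X,Y,Z;-1,0)=X-Y$ and, for $\ell\geq 0$, $1\leq h\leq d-1$, $\Phi(X,Y,Z;\ell,h)=Z^{d^\ell}\big(f^{\circ\ell}(X/Z)-\gamma^h f^{\circ\ell}(Y/Z)\big)$. $\mathcal{C}_G\subset\mathbb{P}^k$ (coordinates $(X_0:\dots:X_k)$) is defined by $\Phi(X_a,X_b,X_0;\xi_G(a,b),\eta_G(a,b))=0$ for all edges $\overline{ab}$ of $G$. -}

module Defs where

open import Level using (Level; _⊔_) renaming (suc to lsuc)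
open import Algebra.Bundles using (CommutativeRing)
open import Data.Nat as ℕ using (ℕ; zero; suc; _^_)
open import Data.Nat.Divisibility as ℕD using ()
open import Data.Integer as ℤ using (ℤ; +_; -[1+_])
open import Data.Integer.Divisibility as ℤD using ()
open import Data.Fin using (Fin) renaming (zero to fzero; suc to fsuc)
open import Data.List using (List; []; _∷_; _++_; [_])
open import Data.Product using (Σ; ∃; _×_)
open import Data.Sum using (_⊎_)
open import Relation.Nullary using (¬_)
open import Relation.Binary.PropositionalEquality using (_≡_; _≢_)

module RingUtils {c ℓ} (R : CommutativeRing c ℓ) where
  open CommutativeRing R

  pow : Carrier → ℕ → Carrier
  pow x zero    = 1#
  pow x (suc n) = x * pow x n

  ι : ℕ → Carrier
  ι zero    = 0#
  ι (suc n) = 1# + ι n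

  eval : List Carrier → Carrier → Carrier
  eval []       x = 0#
  eval (a ∷ as) x = a + x * eval as x

record AlgClosedField (c ℓ : Level) : Set (lsuc (c ⊔ ℓ)) where
  field
    cring : CommutativeRing c ℓ
  open CommutativeRing cring public
  open RingUtils cring public
  field
    1≉0      : ¬ (1# ≈ 0#)
    inverse  : ∀ x → ¬ (x ≈ 0#) → ∃ λ y → x * y ≈ 1#
    -- every polynomial a₀ + a₁X + … + aₙXⁿ with n ≥ 1 and aₙ ≠ 0 has a root
    closed   : ∀ (a₀ : Carrier) (as : List Carrier) (lead : Carrier) →
               ¬ (lead ≈ 0#) → ∃ λ x → eval (a₀ ∷ (as ++ [ lead ])) x ≈ 0#

-- Complete (r,k,d)-graphs.  Vertices {1,…,k} are Fin k; values of ξ, η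
-- are only meaningful on pairs of distinct vertices (all of which are edges).

-ℤ1 : ℤ
-ℤ1 = -[1+ 0 ]

record CompleteGraph (r : ℤ) (k d : ℕ) : Set where
  field
    ξ : Fin k → Fin k → ℤ
    η : Fin k → Fin k → ℕ
    ξ-range : ∀ a b → a ≢ b → (-ℤ1 ℤ.≤ ξ a b) × (ξ a b ℤ.≤ r)
    η-range : ∀ a b → a ≢ b → η a b ℕ.< d
    ξ-sym   : ∀ a b → a ≢ b → ξ a b ≡ ξ b a
    η-sum   : ∀ a b → a ≢ b → d ℕD.∣ (η a b ℕ.+ η b a)
    η-neg   : ∀ a b → a ≢ b → ξ a b ≡ -ℤ1 → η a b ≡ 0
    η-nonneg : ∀ a b → a ≢ b → + 0 ℤ.≤ ξ a b → 1 ℕ.≤ η a b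
  -- (η a b ≤ d - 1 is η-range)

open CompleteGraph public

_≡_[mod_] : ℕ → ℕ → ℕ → Set
m ≡ n [mod d ] = (+ d) ℤD.∣ (+ m ℤ.- + n)

-- proper graphs (conditions (1)–(4), for all distinct a, b, c;
-- every pair is an edge since the graph is complete)
record Proper {r : ℤ} {k d : ℕ} (G : CompleteGraph r k d) : Set where
  field
    cond1 : ∀ a b c → a ≢ b → a ≢ c → b ≢ c →
            ξ G a b ≡ -ℤ1 → ξ G b c ≡ -ℤ1 → ξ G a c ≡ -ℤ1
    cond2 : ∀ a b c → a ≢ b → a ≢ c → b ≢ c →
            ξ G a b ℤ.< ξ G b c → (ξ G a c ≡ ξ G b c) × (η G a c ≡ η G b c)
    cond3 : ∀ a b c → a ≢ b → a ≢ c → b ≢ c →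
            + 0 ℤ.≤ ξ G a b → ξ G a b ≡ ξ G b c → η G a b ℕ.+ η G b c ≢ d →
            (ξ G a c ≡ ξ G a b) × (η G a c ≡ η G a b ℕ.+ η G b c [mod d ])
    cond4 : ∀ a b c → a ≢ b → a ≢ c → b ≢ c →
            + 0 ℤ.≤ ξ G a b → ξ G a b ≡ ξ G b c → η G a b ℕ.+ η G b c ≡ d →
            ξ G a c ℤ.< ξ G a b

GraphEq : {r : ℤ} {k d : ℕ} → CompleteGraph r k d → CompleteGraph r k d → Set
GraphEq {k = k} G₁ G₂ = ∀ (a b : Fin k) → a ≢ b →
  (ξ G₁ a b ≡ ξ G₂ a b) × (η G₁ a b ≡ η G₂ a b)

module Curves {c ℓ} (K : AlgClosedField c ℓ) (d : ℕ) (A C γ : AlgClosedField.Carrier K) where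
  open AlgClosedField K

  -- F ℓ X Z = Z^(d^ℓ) · f^{∘ℓ}(X/Z) for f(X) = A X^d + C, as a homogeneous
  -- polynomial: F 0 X Z = X,  F (ℓ+1) X Z = A (F ℓ X Z)^d + C Z^(d^(ℓ+1)).
  F : ℕ → Carrier → Carrier → Carrier
  F zero    X Z = X
  F (suc l) X Z = A * pow (F l X Z) d + C * pow Z (d ^ suc l)

  Φ : Carrier → Carrier → Carrier → ℤ → ℕ → Carrier
  Φ X Y Z -[1+ _ ] h = X - Y
  Φ X Y Z (+ l)    h = F l X Z - pow γ h * F l Y Z

  -- a vector of homogeneous coordinates (X₀ : … : X_k), vertex a ↔ X_a
  NonZeroVec : (k : ℕ) → (Fin (suc k) → Carrier) → Set ℓ
  NonZeroVec k x = ¬ (∀ i → x i ≈ 0#)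

  OnCurve : {r : ℤ} {k : ℕ} → CompleteGraph r k d → (Fin (suc k) → Carrier) → Set ℓ
  OnCurve {k = k} G x = ∀ (a b : Fin k) → a ≢ b →
    Φ (x (fsuc a)) (x (fsuc b)) (x fzero) (ξ G a b) (η G a b) ≈ 0#

  SameCurve : {r : ℤ} {k : ℕ} → CompleteGraph r k d → CompleteGraph r k d → Set (c ⊔ ℓ)
  SameCurve {k = k} G₁ G₂ = ∀ (x : Fin (suc k) → Carrier) → NonZeroVec k x →
    (OnCurve G₁ x → OnCurve G₂ x) × (OnCurve G₂ x → OnCurve G₁ x)

{-# OPTIONS --safe #-}
-- On the hyperplane X₀ = 0 the equation Φ(X_a, X_b, 0; ℓ, h) = 0 of an edge reduces to
-- X_a^(d^ℓ) = γ^h X_b^(d^ℓ) (to X_a = X_b when ℓ = -1). A relation of level ℓ implies the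
-- relation of every higher level with h = 0, so when X_b ≠ 0 and γ is a primitive d-th root of
-- unity such an equation determines the admissible label (ℓ, h). For a complete proper graph G₁
-- one builds, vertex by vertex, a point at infinity with all X_a ≠ 0 satisfying every edge
-- equation of G₁: a new vertex v is placed over an old vertex b with ξ(v, b) minimal, and the
-- properness conditions carry the relation from b to every other old vertex. This point lies on
-- C_{G₁} = C_{G₂}, so its coordinates also determine the labels of G₂, whence G₁ = G₂.
module Submission where

open import Defs
open import Level using (0ℓ; _⊔_)
open import Algebra.Bundles using (CommutativeRing)
open import Data.Nat as ℕ using (ℕ; zero; suc; _≤_; _<_; _∸_; _^_; NonZero; z≤n)
import Data.Nat.Properties as ℕₚ
open import Data.Nat.Divisibility using (_∣_; divides; ∣-trans; n∣m*n; m∣m*n)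
open import Data.Nat.Primality using (Prime)
open import Data.Integer as ℤ using (ℤ; +_; -[1+_])
import Data.Integer.Properties as ℤₚ
open import Data.Fin using (Fin) renaming (zero to fzero; suc to fsuc)
import Data.Fin.Properties as Finₚ
open import Data.List using (List; []; _∷_; allFin)
open import Data.List.Relation.Unary.Any using (here; there)
open import Data.List.Relation.Unary.All as All using (All)
open import Data.List.Relation.Unary.AllPairs using (_∷_)
open import Data.List.Relation.Unary.Unique.Propositional using (Unique)
open import Data.List.Relation.Unary.Unique.Propositional.Properties using (allFin⁺)
open import Data.List.Membership.Propositional using (_∈_)
open import Data.List.Membership.Propositional.Properties using (∈-allFin)
open import Data.List.Extrema ℤₚ.≤-totalOrder using (argmin; argmin-sel; f[argmin]≤f[⊤]; f[argmin]≤f[xs])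
open import Data.Vec.Functional as Vector using (updateAt)
open import Data.Vec.Functional.Properties using (updateAt-updates; updateAt-minimal)
open import Data.Product using (_×_; _,_; ∃; proj₁)
open import Data.Sum using (_⊎_; inj₁; inj₂)
open import Data.Empty using (⊥-elim)
open import Function using (const)
open import Relation.Nullary using (¬_; yes; no)
open import Relation.Binary.Definitions using (tri<; tri≈; tri>)
open import Relation.Binary.PropositionalEquality as ≡ using (_≡_; _≢_)

module _ {A : Set} (f : A → ℤ) (w : A) (ws : List A) where

  argmin∈ : argmin f w ws ∈ w ∷ ws
  argmin∈ with argmin-sel f w ws
  ... | inj₁ ≡w  = here ≡w
  ... | inj₂ ∈ws = there ∈ws

  argmin-minimal : ∀ {c} → c ∈ w ∷ ws → f (argmin f w ws) ℤ.≤ f c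
  argmin-minimal (here ≡.refl) = f[argmin]≤f[⊤] {f = f} w ws
  argmin-minimal (there c∈ws)  = All.lookup (f[argmin]≤f[xs] {f = f} w ws) c∈ws

module PowerProperties {c ℓ} (R : CommutativeRing c ℓ) where
  open CommutativeRing R
  open RingUtils R
  import Algebra.Properties.CommutativeSemiring.Exp commutativeSemiring as Exp

  pow≡^ : ∀ x n → pow x n ≡ x Exp.^ n
  pow≡^ x zero    = ≡.refl
  pow≡^ x (suc n) = ≡.cong (x *_) (pow≡^ x n)

  pow-congˡ : ∀ n {x y} → x ≈ y → pow x n ≈ pow y n
  pow-congˡ n {x} {y} rewrite pow≡^ x n | pow≡^ y n = Exp.^-congˡ n

  pow-homo-* : ∀ x m n → pow x (m ℕ.+ n) ≈ pow x m * pow x n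
  pow-homo-* x m n rewrite pow≡^ x (m ℕ.+ n) | pow≡^ x m | pow≡^ x n = Exp.^-homo-* x m n

  pow-assocʳ : ∀ x m n → pow (pow x m) n ≈ pow x (m ℕ.* n)
  pow-assocʳ x m n rewrite pow≡^ x m | pow≡^ (x Exp.^ m) n | pow≡^ x (m ℕ.* n) = Exp.^-assocʳ x m n

  pow-distrib-* : ∀ x y n → pow (x * y) n ≈ pow x n * pow y n
  pow-distrib-* x y n rewrite pow≡^ (x * y) n | pow≡^ x n | pow≡^ y n = Exp.^-distrib-* x y n

  pow-1# : ∀ n → pow 1# n ≈ 1#
  pow-1# zero    = refl
  pow-1# (suc n) = trans (*-identityˡ _) (pow-1# n)

  pow-0# : ∀ {n} → 0 < n → pow 0# n ≈ 0#
  pow-0# {suc n} _ = zeroˡ _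

module FieldProperties {c ℓ} (K : AlgClosedField c ℓ) where
  open AlgClosedField K
  open PowerProperties cring
  open import Relation.Binary.Reasoning.Setoid setoid
  open import Algebra.Properties.Group +-group using (x∙y⁻¹≈ε⇒x≈y)
  open import Data.List using (replicate; _++_; [_])

  *-cancelˡ : ∀ {x y z} → x ≉ 0# → x * y ≈ x * z → y ≈ z
  *-cancelˡ {x} {y} {z} x≉0 xy≈xz with inverse x x≉0
  ... | w , xw≈1 = begin
    y             ≈⟨ *-identityˡ y ⟨
    1# * y        ≈⟨ *-congʳ (trans (*-comm w x) xw≈1) ⟨
    (w * x) * y   ≈⟨ *-assoc w x y ⟩
    w * (x * y)   ≈⟨ *-congˡ xy≈xz ⟩
    w * (x * z)   ≈⟨ *-assoc w x z ⟨
    (w * x) * z   ≈⟨ *-congʳ (trans (*-comm w x) xw≈1) ⟩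
    1# * z        ≈⟨ *-identityˡ z ⟩
    z             ∎

  *-cancelʳ : ∀ {x y z} → z ≉ 0# → x * z ≈ y * z → x ≈ y
  *-cancelʳ {x} {y} {z} z≉0 xz≈yz = *-cancelˡ z≉0 (trans (*-comm z x) (trans xz≈yz (*-comm y z)))

  x*y≉0 : ∀ {x y} → x ≉ 0# → y ≉ 0# → x * y ≉ 0#
  x*y≉0 {x} x≉0 y≉0 xy≈0 = y≉0 (*-cancelˡ x≉0 (trans xy≈0 (sym (zeroʳ x))))

  pow≉0 : ∀ {x} n → x ≉ 0# → pow x n ≉ 0#
  pow≉0 zero    _   = 1≉0
  pow≉0 (suc n) x≉0 = x*y≉0 x≉0 (pow≉0 n x≉0)

  eval-monomial : ∀ m x → eval (replicate m 0# ++ [ 1# ]) x ≈ pow x m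
  eval-monomial zero    x = trans (+-congˡ (zeroʳ x)) (+-identityʳ 1#)
  eval-monomial (suc m) x = trans (+-identityˡ _) (*-congˡ (eval-monomial m x))

  root-exists : ∀ {n} → 0 < n → ∀ t → ∃ λ ρ → pow ρ n ≈ t
  root-exists {suc m} _ t with closed (- t) (replicate m 0#) 1# 1≉0
  ... | ρ , root = ρ , x∙y⁻¹≈ε⇒x≈y (pow ρ (suc m)) t (begin
    pow ρ (suc m) - t                                  ≈⟨ +-comm _ (- t) ⟩
    - t + ρ * pow ρ m                                  ≈⟨ +-congˡ (*-congˡ (eval-monomial m ρ)) ⟨
    - t + ρ * eval (replicate m 0# ++ [ 1# ]) ρ        ≈⟨ root ⟩
    0#                                                 ∎)

module RootOfUnity {c ℓ} (K : AlgClosedField c ℓ) (d : ℕ) .{{_ : NonZero d}}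
  (γ : AlgClosedField.Carrier K)
  (γ^d≈1 : AlgClosedField._≈_ K (AlgClosedField.pow K γ d) (AlgClosedField.1# K))
  (γ^j≉1 : ∀ j → 1 ≤ j → j < d → ¬ AlgClosedField._≈_ K (AlgClosedField.pow K γ j) (AlgClosedField.1# K))
  where
  open AlgClosedField K
  open PowerProperties cring
  open FieldProperties K
  open import Relation.Binary.Reasoning.Setoid setoid

  γ≉0 : γ ≉ 0#
  γ≉0 γ≈0 = 1≉0 (begin
    1#       ≈⟨ γ^d≈1 ⟨
    pow γ d  ≈⟨ pow-congˡ d γ≈0 ⟩
    pow 0# d ≈⟨ pow-0# (ℕ.>-nonZero⁻¹ d) ⟩
    0#       ∎)

  d∣m⇒γ^m≈1 : ∀ {m} → d ∣ m → pow γ m ≈ 1#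
  d∣m⇒γ^m≈1 (divides q ≡.refl) = begin
    pow γ (q ℕ.* d)   ≡⟨ ≡.cong (pow γ) (ℕₚ.*-comm q d) ⟩
    pow γ (d ℕ.* q)   ≈⟨ pow-assocʳ γ d q ⟨
    pow (pow γ d) q   ≈⟨ pow-congˡ q γ^d≈1 ⟩
    pow 1# q          ≈⟨ pow-1# q ⟩
    1#                ∎

  γ^m≈γ^n : ∀ {m n} → n ≤ m → d ∣ m ∸ n → pow γ m ≈ pow γ n
  γ^m≈γ^n {m} {n} n≤m d∣m∸n = begin
    pow γ m                         ≡⟨ ≡.cong (pow γ) (ℕₚ.m+[n∸m]≡n n≤m) ⟨
    pow γ (n ℕ.+ (m ∸ n))           ≈⟨ pow-homo-* γ n (m ∸ n) ⟩
    pow γ n * pow γ (m ∸ n)         ≈⟨ *-congˡ (d∣m⇒γ^m≈1 d∣m∸n) ⟩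
    pow γ n * 1#                    ≈⟨ *-identityʳ _ ⟩
    pow γ n                         ∎

  γ^-resp-mod : ∀ {m n} → m ≡ n [mod d ] → pow γ m ≈ pow γ n
  γ^-resp-mod {m} {n} d∣m-n with ℕₚ.≤-total n m
  ... | inj₁ n≤m = γ^m≈γ^n n≤m (≡.subst (d ∣_) ∣m-n∣≡m∸n d∣m-n)
    where
    ∣m-n∣≡m∸n : ℤ.∣ + m ℤ.- + n ∣ ≡ m ∸ n
    ∣m-n∣≡m∸n = ≡.cong ℤ.∣_∣ (≡.trans (ℤₚ.m-n≡m⊖n m n) (ℤₚ.⊖-≥ n≤m))
  ... | inj₂ m≤n = sym (γ^m≈γ^n m≤n (≡.subst (d ∣_) ∣m-n∣≡n∸m d∣m-n))
    where
    ∣m-n∣≡n∸m : ℤ.∣ + m ℤ.- + n ∣ ≡ n ∸ m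
    ∣m-n∣≡n∸m = ≡.trans (≡.cong ℤ.∣_∣ (ℤₚ.m-n≡m⊖n m n)) (ℤₚ.∣⊖∣-≤ m≤n)

  γ^-distinct : ∀ {m n} → m < n → n < d → pow γ m ≉ pow γ n
  γ^-distinct {m} {n} m<n n<d γ^m≈γ^n =
    γ^j≉1 (n ∸ m) (ℕₚ.m<n⇒0<n∸m m<n) (ℕₚ.≤-<-trans (ℕₚ.m∸n≤m n m) n<d)
      (sym (*-cancelˡ (pow≉0 m γ≉0) (begin
        pow γ m * 1#                ≈⟨ *-identityʳ _ ⟩
        pow γ m                     ≈⟨ γ^m≈γ^n ⟩
        pow γ n                     ≡⟨ ≡.cong (pow γ) (ℕₚ.m+[n∸m]≡n (ℕₚ.<⇒≤ m<n)) ⟨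
        pow γ (m ℕ.+ (n ∸ m))       ≈⟨ pow-homo-* γ m (n ∸ m) ⟩
        pow γ m * pow γ (n ∸ m)     ∎)))

  γ^-injective : ∀ {m n} → m < d → n < d → pow γ m ≈ pow γ n → m ≡ n
  γ^-injective {m} {n} m<d n<d γ^m≈γ^n with ℕₚ.<-cmp m n
  ... | tri< m<n _ _ = ⊥-elim (γ^-distinct m<n n<d γ^m≈γ^n)
  ... | tri≈ _ m≡n _ = m≡n
  ... | tri> _ _ n<m = ⊥-elim (γ^-distinct n<m m<d (sym γ^m≈γ^n))

  -- Related s h x y is the equation Φ(x, y, 0; s, h) = 0 of an edge labelled (s, h) on the
  -- hyperplane X₀ = 0, with the nonzero leading coefficient of f^{∘s} divided out.
  Related : ℤ → ℕ → Carrier → Carrier → Set ℓ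
  Related -[1+ _ ] _ x y = x ≈ y
  Related (+ l)    h x y = pow x (d ^ l) ≈ pow γ h * pow y (d ^ l)

  data Label : ℤ → ℕ → Set where
    diagonal : Label -ℤ1 0
    twisted  : ∀ l {h} → 1 ≤ h → h < d → Label (+ l) h

  Label⇒≡-1⊎≥0 : ∀ {s h} → Label s h → s ≡ -ℤ1 ⊎ + 0 ℤ.≤ s
  Label⇒≡-1⊎≥0 diagonal        = inj₁ ≡.refl
  Label⇒≡-1⊎≥0 (twisted _ _ _) = inj₂ (ℤ.+≤+ z≤n)

  Related-sym : ∀ s {h h′ x y} → d ∣ h ℕ.+ h′ → Related s h x y → Related s h′ y x
  Related-sym -[1+ _ ] _ x≈y = sym x≈y
  Related-sym (+ l) {h} {h′} {x} {y} d∣h+h′ x~y = begin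
    pow y (d ^ l)                        ≈⟨ *-identityˡ _ ⟨
    1# * pow y (d ^ l)                   ≈⟨ *-congʳ (d∣m⇒γ^m≈1 (≡.subst (d ∣_) (ℕₚ.+-comm h h′) d∣h+h′)) ⟨
    pow γ (h′ ℕ.+ h) * pow y (d ^ l)     ≈⟨ *-congʳ (pow-homo-* γ h′ h) ⟩
    (pow γ h′ * pow γ h) * pow y (d ^ l) ≈⟨ *-assoc _ _ _ ⟩
    pow γ h′ * (pow γ h * pow y (d ^ l)) ≈⟨ *-congˡ x~y ⟨
    pow γ h′ * pow x (d ^ l)             ∎

  Related-trans : ∀ {s h h′ x y z} → + 0 ℤ.≤ s →
                  Related s h x y → Related s h′ y z → Related s (h ℕ.+ h′) x z
  Related-trans {+ l} {h} {h′} {x} {y} {z} _ x~y y~z = begin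
    pow x (d ^ l)                        ≈⟨ x~y ⟩
    pow γ h * pow y (d ^ l)              ≈⟨ *-congˡ y~z ⟩
    pow γ h * (pow γ h′ * pow z (d ^ l)) ≈⟨ *-assoc _ _ _ ⟨
    (pow γ h * pow γ h′) * pow z (d ^ l) ≈⟨ *-congʳ (pow-homo-* γ h h′) ⟨
    pow γ (h ℕ.+ h′) * pow z (d ^ l)     ∎

  Related-resp-mod : ∀ s {h h′ x y} → h′ ≡ h [mod d ] → Related s h x y → Related s h′ x y
  Related-resp-mod -[1+ _ ] _ x≈y = x≈y
  Related-resp-mod (+ l) {h} {h′} h′≡h x~y = trans x~y (*-congʳ (sym (γ^-resp-mod {h′} {h} h′≡h)))

  Related⇒pow≈pow : ∀ l {h x y} e → d ∣ e → Related (+ l) h x y → pow x (d ^ l ℕ.* e) ≈ pow y (d ^ l ℕ.* e)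
  Related⇒pow≈pow l {h} {x} {y} e d∣e x~y = begin
    pow x (d ^ l ℕ.* e)                            ≈⟨ pow-assocʳ x (d ^ l) e ⟨
    pow (pow x (d ^ l)) e                          ≈⟨ pow-congˡ e x~y ⟩
    pow (pow γ h * pow y (d ^ l)) e                ≈⟨ pow-distrib-* _ _ e ⟩
    pow (pow γ h) e * pow (pow y (d ^ l)) e        ≈⟨ *-cong γ^he≈1 (pow-assocʳ y (d ^ l) e) ⟩
    1# * pow y (d ^ l ℕ.* e)                       ≈⟨ *-identityˡ _ ⟩
    pow y (d ^ l ℕ.* e)                            ∎
    where
    γ^he≈1 : pow (pow γ h) e ≈ 1#
    γ^he≈1 = trans (pow-assocʳ γ h e) (d∣m⇒γ^m≈1 (∣-trans d∣e (n∣m*n h)))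

  Related-lift : ∀ s {h x y m} → s ℤ.< + m → Related s h x y → pow x (d ^ m) ≈ pow y (d ^ m)
  Related-lift -[1+ _ ] {m = m} _ x≈y = pow-congˡ (d ^ m) x≈y
  Related-lift (+ l) {h} {x} {y} +l<+m x~y with ℕₚ.m≤n⇒∃[o]m+o≡n (ℤₚ.drop‿+<+ +l<+m)
  ... | o , ≡.refl = ≡.subst (λ n → pow x n ≈ pow y n) d^l*d^[1+o]≡d^[1+l+o]
                       (Related⇒pow≈pow l {h} (d ^ suc o) (m∣m*n (d ^ o)) x~y)
    where
    d^l*d^[1+o]≡d^[1+l+o] : d ^ l ℕ.* d ^ suc o ≡ d ^ (suc l ℕ.+ o)
    d^l*d^[1+o]≡d^[1+l+o] = ≡.trans (≡.sym (ℕₚ.^-distribˡ-+-* d l (suc o))) (≡.cong (d ^_) (ℕₚ.+-suc l o))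

  Related-climb : ∀ {s t h h′ x y z} → Label s h → s ℤ.< t →
                  Related s h x y → Related t h′ y z → Related t h′ x z
  Related-climb {s} {+ m} {h} _ s<t x~y y~z = trans (Related-lift s {h} {m = m} s<t x~y) y~z
  Related-climb {t = -[1+ _ ]} diagonal (ℤ.-<- ())
  Related-climb {t = -[1+ _ ]} (twisted _ _ _) ()

  Related-gap : ∀ {s m h h′ x y} → y ≉ 0# → s ℤ.< + m → 1 ≤ h′ → h′ < d →
                Related s h x y → ¬ Related (+ m) h′ x y
  Related-gap {s} {m} {h} {h′} {x} {y} y≉0 s<m 1≤h′ h′<d x~y x~′y =
    γ^j≉1 h′ 1≤h′ h′<d (*-cancelʳ (pow≉0 (d ^ m) y≉0) (begin
      pow γ h′ * pow y (d ^ m) ≈⟨ x~′y ⟨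
      pow x (d ^ m)            ≈⟨ Related-lift s {h} s<m x~y ⟩
      pow y (d ^ m)            ≈⟨ *-identityˡ _ ⟨
      1# * pow y (d ^ m)       ∎))

  Related-unique : ∀ {s s′ h h′ x y} → y ≉ 0# → Label s h → Label s′ h′ →
                   Related s h x y → Related s′ h′ x y → s ≡ s′ × h ≡ h′
  Related-unique _ diagonal diagonal _ _ = ≡.refl , ≡.refl
  Related-unique y≉0 diagonal (twisted m 1≤h′ h′<d) x~y x~′y =
    ⊥-elim (Related-gap { -ℤ1} {m} {0} y≉0 ℤ.-<+ 1≤h′ h′<d x~y x~′y)
  Related-unique y≉0 (twisted l 1≤h h<d) diagonal x~y x~′y =
    ⊥-elim (Related-gap { -ℤ1} {l} {0} y≉0 ℤ.-<+ 1≤h h<d x~′y x~y)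
  Related-unique {h = h} {h′} y≉0 (twisted l 1≤h h<d) (twisted m 1≤h′ h′<d) x~y x~′y with ℕₚ.<-cmp l m
  ... | tri< l<m _ _ = ⊥-elim (Related-gap {h = h} y≉0 (ℤ.+<+ l<m) 1≤h′ h′<d x~y x~′y)
  ... | tri> _ _ m<l = ⊥-elim (Related-gap {h = h′} y≉0 (ℤ.+<+ m<l) 1≤h h<d x~′y x~y)
  ... | tri≈ _ ≡.refl _ =
    ≡.refl , γ^-injective h<d h′<d (*-cancelʳ (pow≉0 (d ^ l) y≉0) (trans (sym x~y) x~′y))

  Related-scaling : ∀ s h → ∃ λ ρ → ρ ≉ 0# × (∀ y → Related s h (ρ * y) y)
  Related-scaling -[1+ _ ] h = 1# , 1≉0 , *-identityˡ
  Related-scaling (+ l) h with root-exists (ℕₚ.m^n>0 d l) (pow γ h)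
  ... | ρ , ρ^D≈γ^h = ρ , ρ≉0 , λ y → trans (pow-distrib-* ρ y (d ^ l)) (*-congʳ ρ^D≈γ^h)
    where
    ρ≉0 : ρ ≉ 0#
    ρ≉0 ρ≈0 = pow≉0 h γ≉0 (begin
      pow γ h        ≈⟨ ρ^D≈γ^h ⟨
      pow ρ (d ^ l)  ≈⟨ pow-congˡ (d ^ l) ρ≈0 ⟩
      pow 0# (d ^ l) ≈⟨ pow-0# (ℕₚ.m^n>0 d l) ⟩
      0#             ∎)

  module AtInfinity (A C : Carrier) (A≉0 : A ≉ 0#) where
    open Curves K d A C γ
    open import Algebra.Properties.CommutativeSemigroup *-commutativeSemigroup using (x∙yz≈y∙xz)
    open import Algebra.Properties.Group +-group using (x∙y⁻¹≈ε⇒x≈y; x≈y⇒x∙y⁻¹≈ε)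

    leading : ℕ → Carrier
    leading zero    = 1#
    leading (suc l) = A * pow (leading l) d

    leading≉0 : ∀ l → leading l ≉ 0#
    leading≉0 zero    = 1≉0
    leading≉0 (suc l) = x*y≉0 A≉0 (pow≉0 d (leading≉0 l))

    F-at-infinity : ∀ l X → F l X 0# ≈ leading l * pow X (d ^ l)
    F-at-infinity zero    X = sym (trans (*-identityˡ _) (*-identityʳ X))
    F-at-infinity (suc l) X = begin
      A * pow (F l X 0#) d + C * pow 0# (d ^ suc l)   ≈⟨ +-cong (*-congˡ (pow-congˡ d (F-at-infinity l X)))
                                                                (trans (*-congˡ (pow-0# (ℕₚ.m^n>0 d (suc l)))) (zeroʳ C)) ⟩
      A * pow (leading l * pow X (d ^ l)) d + 0#      ≈⟨ +-identityʳ _ ⟩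
      A * pow (leading l * pow X (d ^ l)) d           ≈⟨ *-congˡ (pow-distrib-* (leading l) (pow X (d ^ l)) d) ⟩
      A * (pow (leading l) d * pow (pow X (d ^ l)) d) ≈⟨ *-assoc _ _ _ ⟨
      leading (suc l) * pow (pow X (d ^ l)) d         ≈⟨ *-congˡ (pow-assocʳ X (d ^ l) d) ⟩
      leading (suc l) * pow X (d ^ l ℕ.* d)           ≡⟨ ≡.cong (λ n → leading (suc l) * pow X n) (ℕₚ.*-comm (d ^ l) d) ⟩
      leading (suc l) * pow X (d ^ suc l)             ∎

    Φ≈0⇒Related : ∀ s h {X Y} → Φ X Y 0# s h ≈ 0# → Related s h X Y
    Φ≈0⇒Related -[1+ _ ] _ {X} {Y} Φ≈0 = x∙y⁻¹≈ε⇒x≈y X Y Φ≈0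
    Φ≈0⇒Related (+ l) h {X} {Y} Φ≈0 = *-cancelˡ (leading≉0 l) (begin
      leading l * pow X (d ^ l)             ≈⟨ F-at-infinity l X ⟨
      F l X 0#                              ≈⟨ x∙y⁻¹≈ε⇒x≈y _ _ Φ≈0 ⟩
      pow γ h * F l Y 0#                    ≈⟨ *-congˡ (F-at-infinity l Y) ⟩
      pow γ h * (leading l * pow Y (d ^ l)) ≈⟨ x∙yz≈y∙xz _ _ _ ⟩
      leading l * (pow γ h * pow Y (d ^ l)) ∎)

    Related⇒Φ≈0 : ∀ s h {X Y} → Related s h X Y → Φ X Y 0# s h ≈ 0#
    Related⇒Φ≈0 -[1+ _ ] _ X≈Y = x≈y⇒x∙y⁻¹≈ε X≈Y
    Related⇒Φ≈0 (+ l) h {X} {Y} X~Y = x≈y⇒x∙y⁻¹≈ε (begin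
      F l X 0#                              ≈⟨ F-at-infinity l X ⟩
      leading l * pow X (d ^ l)             ≈⟨ *-congˡ X~Y ⟩
      leading l * (pow γ h * pow Y (d ^ l)) ≈⟨ x∙yz≈y∙xz _ _ _ ⟩
      pow γ h * (leading l * pow Y (d ^ l)) ≈⟨ *-congˡ (F-at-infinity l Y) ⟨
      pow γ h * F l Y 0#                    ∎)

    OnCurve⇒Related : ∀ {r k} (G : CompleteGraph r k d) {u : Fin k → Carrier} → OnCurve G (0# Vector.∷ u) →
                      ∀ {a b} → a ≢ b → Related (ξ G a b) (η G a b) (u a) (u b)
    OnCurve⇒Related G u∈C {a} {b} a≢b = Φ≈0⇒Related (ξ G a b) (η G a b) (u∈C a b a≢b)

    Related⇒OnCurve : ∀ {r k} (G : CompleteGraph r k d) {u : Fin k → Carrier} →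
                      (∀ {a b} → a ≢ b → Related (ξ G a b) (η G a b) (u a) (u b)) → OnCurve G (0# Vector.∷ u)
    Related⇒OnCurve G u~ a b a≢b = Related⇒Φ≈0 (ξ G a b) (η G a b) (u~ a≢b)

  edge-label : ∀ {r k} (G : CompleteGraph r k d) {a b} → a ≢ b → Label (ξ G a b) (η G a b)
  edge-label G {a} {b} a≢b
    with ξ G a b | proj₁ (ξ-range G a b a≢b) | η-neg G a b a≢b | η-nonneg G a b a≢b
  ... | -[1+ 0 ]     | _           | η≡0 | _   = ≡.subst (Label -ℤ1) (≡.sym (η≡0 ≡.refl)) diagonal
  ... | -[1+ suc _ ] | ℤ.-≤- ()    | _   | _
  ... | + l          | _           | _   | 1≤η = twisted l (1≤η (ℤ.+≤+ z≤n)) (η-range G a b a≢b)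

  module ProperGraph {r k} (G : CompleteGraph r k d) (proper : Proper G) where
    open Proper proper

    Related[_,_] : Fin k → Fin k → Carrier → Carrier → Set ℓ
    Related[ a , b ] = Related (ξ G a b) (η G a b)

    Related[]-sym : ∀ {a b x y} → a ≢ b → Related[ a , b ] x y → Related[ b , a ] y x
    Related[]-sym {a} {b} a≢b x~y =
      ≡.subst (λ s → Related s (η G b a) _ _) (ξ-sym G a b a≢b) (Related-sym (ξ G a b) (η-sum G a b a≢b) x~y)

    Related[]-ascending : ∀ {v b c x y z} → v ≢ b → v ≢ c → b ≢ c → ξ G v b ℤ.< ξ G b c →
                          Related[ v , b ] x y → Related[ b , c ] y z → Related[ v , c ] x z
    Related[]-ascending {v} {b} {c} {x} {_} {z} v≢b v≢c b≢c vb<bc x~y y~z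
      with cond2 v b c v≢b v≢c b≢c vb<bc
    ... | ξ≡ , η≡ = ≡.subst₂ (λ s h → Related s h x z) (≡.sym ξ≡) (≡.sym η≡)
                      (Related-climb (edge-label G v≢b) vb<bc x~y y~z)

    Related[]-descending : ∀ {v b c x y z} → v ≢ b → v ≢ c → b ≢ c → ξ G b c ℤ.< ξ G v b →
                           Related[ v , b ] x y → Related[ b , c ] y z → Related[ v , c ] x z
    Related[]-descending {v} {b} {c} v≢b v≢c b≢c bc<vb x~y y~z =
      Related[]-sym (≡.≢-sym v≢c)
        (Related[]-ascending (≡.≢-sym b≢c) (≡.≢-sym v≢c) (≡.≢-sym v≢b) cb<bv (Related[]-sym b≢c y~z) (Related[]-sym v≢b x~y))
      where
      cb<bv : ξ G c b ℤ.< ξ G b v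
      cb<bv = ≡.subst₂ ℤ._<_ (ξ-sym G b c b≢c) (ξ-sym G v b v≢b) bc<vb

    Related[]-level : ∀ {v b c x y z} → v ≢ b → v ≢ c → b ≢ c → ξ G v b ≡ ξ G b c → ξ G v b ℤ.≤ ξ G v c →
                      Related[ v , b ] x y → Related[ b , c ] y z → Related[ v , c ] x z
    Related[]-level {v} {b} {c} {x} {y} {z} v≢b v≢c b≢c vb≡bc vb≤vc x~y y~z
      with Label⇒≡-1⊎≥0 (edge-label G v≢b)
    ... | inj₁ vb≡-1 = ≡.subst (λ s → Related s (η G v c) x z) (≡.sym vc≡-1)
                         (trans (≡.subst (λ s → Related s (η G v b) x y) vb≡-1 x~y)
                                (≡.subst (λ s → Related s (η G b c) y z) bc≡-1 y~z))
      where
      bc≡-1 = ≡.trans (≡.sym vb≡bc) vb≡-1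
      vc≡-1 = cond1 v b c v≢b v≢c b≢c vb≡-1 bc≡-1
    ... | inj₂ 0≤vb with η G v b ℕ.+ η G b c ℕₚ.≟ d
    ...   | yes sum≡d = ⊥-elim (ℤₚ.<⇒≱ (cond4 v b c v≢b v≢c b≢c 0≤vb vb≡bc sum≡d) vb≤vc)
    ...   | no sum≢d with cond3 v b c v≢b v≢c b≢c 0≤vb vb≡bc sum≢d
    ...     | ξ≡ , η≡ = ≡.subst (λ s → Related s (η G v c) x z) (≡.sym ξ≡)
                          (Related-resp-mod (ξ G v b) η≡
                            (Related-trans 0≤vb x~y (≡.subst (λ s → Related s (η G b c) y z) (≡.sym vb≡bc) y~z)))

    Related[]-via-min : ∀ {v b c x y z} → v ≢ b → v ≢ c → b ≢ c → ξ G v b ℤ.≤ ξ G v c →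
                        Related[ v , b ] x y → Related[ b , c ] y z → Related[ v , c ] x z
    Related[]-via-min {v} {b} {c} v≢b v≢c b≢c vb≤vc with ℤₚ.<-cmp (ξ G v b) (ξ G b c)
    ... | tri< vb<bc _ _ = Related[]-ascending v≢b v≢c b≢c vb<bc
    ... | tri≈ _ vb≡bc _ = Related[]-level v≢b v≢c b≢c vb≡bc vb≤vc
    ... | tri> _ _ bc<vb = Related[]-descending v≢b v≢c b≢c bc<vb

    record Realisation (vs : List (Fin k)) : Set (c ⊔ ℓ) where
      field
        point   : Fin k → Carrier
        point≉0 : ∀ a → point a ≉ 0#
        related : ∀ {a b} → a ∈ vs → b ∈ vs → a ≢ b → Related[ a , b ] (point a) (point b)

    extend : ∀ {v b vs} → Realisation vs → All (v ≢_) vs → b ∈ vs → (∀ {c} → c ∈ vs → ξ G v b ℤ.≤ ξ G v c) →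
             Realisation (v ∷ vs)
    extend {v} {b} {vs} old v∉vs b∈vs b-minimal with Related-scaling (ξ G v b) (η G v b)
    ... | ρ , ρ≉0 , ρ-related = record { point = point′ ; point≉0 = point′≉0 ; related = related′ }
      where
      open Realisation old

      point′ : Fin k → Carrier
      point′ = updateAt point v (const (ρ * point b))

      point′-new : point′ v ≡ ρ * point b
      point′-new = updateAt-updates v point

      point′-old : ∀ {c} → c ∈ vs → point′ c ≡ point c
      point′-old c∈vs = updateAt-minimal _ v point (≡.≢-sym (All.lookup v∉vs c∈vs))

      point′≉0 : ∀ a → point′ a ≉ 0#
      point′≉0 a with a Finₚ.≟ v
      ... | yes ≡.refl = λ p≈0 → x*y≉0 ρ≉0 (point≉0 b) (trans (reflexive (≡.sym point′-new)) p≈0)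
      ... | no a≢v     = λ p≈0 → point≉0 a (trans (reflexive (≡.sym (updateAt-minimal a v point a≢v))) p≈0)

      new-related : ∀ {c} → c ∈ vs → Related[ v , c ] (ρ * point b) (point c)
      new-related {c} c∈vs with c Finₚ.≟ b
      ... | yes ≡.refl = ρ-related (point b)
      ... | no c≢b = Related[]-via-min (All.lookup v∉vs b∈vs) (All.lookup v∉vs c∈vs) (≡.≢-sym c≢b) (b-minimal c∈vs)
                       (ρ-related (point b)) (related b∈vs c∈vs (≡.≢-sym c≢b))

      related′ : ∀ {a c} → a ∈ v ∷ vs → c ∈ v ∷ vs → a ≢ c → Related[ a , c ] (point′ a) (point′ c)
      related′ (here ≡.refl) (here ≡.refl) v≢v = ⊥-elim (v≢v ≡.refl)
      related′ (here ≡.refl) (there c∈vs) _ =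
        ≡.subst₂ Related[ v , _ ] (≡.sym point′-new) (≡.sym (point′-old c∈vs)) (new-related c∈vs)
      related′ (there a∈vs) (here ≡.refl) _ =
        ≡.subst₂ Related[ _ , v ] (≡.sym (point′-old a∈vs)) (≡.sym point′-new)
          (Related[]-sym (All.lookup v∉vs a∈vs) (new-related a∈vs))
      related′ (there a∈vs) (there c∈vs) a≢c =
        ≡.subst₂ Related[ _ , _ ] (≡.sym (point′-old a∈vs)) (≡.sym (point′-old c∈vs)) (related a∈vs c∈vs a≢c)

    realise : ∀ vs → Unique vs → Realisation vs
    realise []           _ = record { point = const 1# ; point≉0 = const 1≉0 ; related = λ () }
    realise (v ∷ [])     _ = record { point = const 1# ; point≉0 = const 1≉0 ; related = related }
      where
      related : ∀ {a b} → a ∈ v ∷ [] → b ∈ v ∷ [] → a ≢ b → Related[ a , b ] 1# 1#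
      related (here ≡.refl) (here ≡.refl) v≢v = ⊥-elim (v≢v ≡.refl)
    realise (v ∷ w ∷ ws) (v∉ws ∷ unique) =
      extend (realise (w ∷ ws) unique) v∉ws (argmin∈ (ξ G v) w ws) (argmin-minimal (ξ G v) w ws)

lemma2p17 : (p : ℕ) → Prime p → (d : ℕ) → 2 ≤ d → d ∣ (p ∸ 1) →
    (K : AlgClosedField 0ℓ 0ℓ) → AlgClosedField._≈_ K (AlgClosedField.ι K p) (AlgClosedField.0# K) →
    (a c g : ℕ) →
    ¬ AlgClosedField._≈_ K (AlgClosedField.ι K a) (AlgClosedField.0# K) →
    AlgClosedField._≈_ K (AlgClosedField.pow K (AlgClosedField.ι K g) d) (AlgClosedField.1# K) →
    (∀ j → 1 ≤ j → j < d → ¬ AlgClosedField._≈_ K (AlgClosedField.pow K (AlgClosedField.ι K g) j) (AlgClosedField.1# K)) →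
    (k : ℕ) → 1 ≤ k → (r : ℤ) → -ℤ1 ℤ.≤ r →
    (G₁ G₂ : CompleteGraph r k d) → Proper G₁ → Proper G₂ → ¬ GraphEq G₁ G₂ →
    ¬ Curves.SameCurve K d (AlgClosedField.ι K a) (AlgClosedField.ι K c) (AlgClosedField.ι K g) G₁ G₂
lemma2p17 _ _ d 2≤d _ K _ a c g a≉0 γ^d≈1 γ^j≉1 (suc k) _ _ _ G₁ G₂ proper₁ _ G₁≉G₂ same = G₁≉G₂ G₁≈G₂
  where
  open AlgClosedField K
  instance
    d≢0 : NonZero d
    d≢0 = ℕ.>-nonZero (ℕₚ.<-≤-trans ℕ.z<s 2≤d)
  open RootOfUnity K d (ι g) γ^d≈1 γ^j≉1
  open AtInfinity (ι a) (ι c) a≉0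
  open Curves K d (ι a) (ι c) (ι g)
  open ProperGraph G₁ proper₁
  open Realisation (realise (allFin (suc k)) (allFin⁺ (suc k)))

  x≉0 : NonZeroVec (suc k) (0# Vector.∷ point)
  x≉0 x≈0 = point≉0 fzero (x≈0 (fsuc fzero))

  x∈C₁ : OnCurve G₁ (0# Vector.∷ point)
  x∈C₁ = Related⇒OnCurve G₁ (related (∈-allFin _) (∈-allFin _))

  G₁≈G₂ : GraphEq G₁ G₂
  G₁≈G₂ i j i≢j = Related-unique (point≉0 j) (edge-label G₁ i≢j) (edge-label G₂ i≢j)
    (OnCurve⇒Related G₁ x∈C₁ i≢j) (OnCurve⇒Related G₂ (proj₁ (same (0# Vector.∷ point) x≉0) x∈C₁) i≢j)
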